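{- Let $R$ be an EPRF-TRS over a ranked alphabet $\Sigma$ and let $p,q\in T_\Sigma(X)$. Then it is decidable whether $p\Rightarrow^*_R q$.
   Context: A ranked alphabet $\Sigma$ is a finite set of symbols with ranks; $X=\{x_1,x_2,\dots\}$ is a countable set of variables, $T_\Sigma(X)$ the terms over $\Sigma$ and $X$, $T_\Sigma$ the ground terms. A TRS $R$ over $\Sigma$ is a finite set of rules $l\to r$, $l,r\in T_\Sigma(X)$, with every variable of $r$ occurring in $l$; $\Rightarrow_R$ is the rewrite relation, $\Rightarrow^*_R$ its reflexive transitive closure; $sign(R)$ is the set of symbols occurring in the rules. For $L\subseteq T_\Sigma$, $R^*_\Sigma(L)=\{p\mid q\Rightarrow^*_R p,\ q\in L\}$. A bottom-up tree automaton (bta) over $\Sigma$ is a finite automaton with states $A$ (treated as constants), final states $A_f$, rules $\delta(a_1,\dots,a_n)\to a$ and $a\to a'$; it recognizes the ground terms rewriting to a final state. $R$ is an EPRF-TRS if for any given ranked alphabet $\Sigma\supseteq sign(R)$ and finite $L\subseteq T_\Sigma$ one can effectively construct a bta $\mathcal{C}$ over $\Sigma$ with $L(\mathcal{C})=R^*_\Sigma(L)$. -}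

module Defs where

open import Data.Nat using (ℕ)
open import Data.Fin using (Fin)
open import Data.Product using (Σ; _×_; _,_; proj₁; proj₂; ∃)
open import Data.List using (List)
open import Data.List.Membership.Propositional using (_∈_)
open import Data.List.Relation.Unary.All as LAll using ()
open import Data.Vec using (Vec; lookup; _[_]≔_; []; _∷_)
open import Data.Vec.Relation.Unary.All as VAll using ()
open import Data.Vec.Relation.Unary.Any as VAny using ()
open import Data.Vec.Relation.Binary.Pointwise.Inductive using (Pointwise)
open import Relation.Binary.Construct.Closure.ReflexiveTransitive using (Star)
open import Function.Bundles using (_⇔_)

-- Symbols and ranked alphabets.
-- A symbol is a pair (name , rank).  A ranked alphabet is a finite set of
-- symbols, given as a list.

Sym : Set
Sym = ℕ × ℕ

rank : Sym → ℕ
rank = proj₂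

Alphabet : Set
Alphabet = List Sym

data Term : Set where
  var  : ℕ → Term
  node : (f : Sym) → Vec Term (rank f) → Term

data TermOver (A : Alphabet) : Term → Set where
  var  : ∀ x → TermOver A (var x)
  node : ∀ {f ts} → f ∈ A → VAll.All (TermOver A) ts → TermOver A (node f ts)

data GroundOver (A : Alphabet) : Term → Set where
  node : ∀ {f ts} → f ∈ A → VAll.All (GroundOver A) ts → GroundOver A (node f ts)

data _occursIn_ (x : ℕ) : Term → Set where
  here  : x occursIn var x
  there : ∀ {f ts} → VAny.Any (x occursIn_) ts → x occursIn node f ts

mutual
  _⟨_⟩ : Term → (ℕ → Term) → Term
  var x     ⟨ σ ⟩ = σ x
  node f ts ⟨ σ ⟩ = node f (substVec ts σ)

  substVec : ∀ {n} → Vec Term n → (ℕ → Term) → Vec Term n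
  substVec []       σ = []
  substVec (t ∷ ts) σ = (t ⟨ σ ⟩) ∷ substVec ts σ

Rule : Set
Rule = Term × Term

VarCond : Rule → Set
VarCond (l , r) = ∀ x → x occursIn r → x occursIn l

record TRS : Set where
  field
    rules   : List Rule
    varCond : LAll.All VarCond rules
open TRS public

SignIn : TRS → Alphabet → Set
SignIn R A = LAll.All (λ lr → TermOver A (proj₁ lr) × TermOver A (proj₂ lr)) (rules R)

data _⊢_⇒_ (R : TRS) : Term → Term → Set where
  root  : ∀ {l r} (σ : ℕ → Term) → (l , r) ∈ rules R → R ⊢ (l ⟨ σ ⟩) ⇒ (r ⟨ σ ⟩)
  inner : ∀ {f ts t'} (i : Fin (rank f)) → R ⊢ lookup ts i ⇒ t' →
          R ⊢ node f ts ⇒ node f (ts [ i ]≔ t')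

_⊢_⇒*_ : TRS → Term → Term → Set
R ⊢ s ⇒* t = Star (R ⊢_⇒_) s t

_∈Desc[_]_ : Term → TRS → List Term → Set
p ∈Desc[ R ] L = ∃ λ q → q ∈ L × R ⊢ q ⇒* p

record BTA : Set where
  field
    nStates : ℕ
    final   : List (Fin nStates)
    -- rules δ(a_1,…,a_n) → a
    δrules  : List (Σ Sym λ f → Vec (Fin nStates) (rank f) × Fin nStates)
    -- rules a → a'
    εrules  : List (Fin nStates × Fin nStates)
open BTA public

BTAOver : Alphabet → BTA → Set
BTAOver A C = LAll.All (λ r → proj₁ r ∈ A) (δrules C)

data Reaches (C : BTA) : Term → Fin (nStates C) → Set where
  δ-step : ∀ {f as a ts} → (f , as , a) ∈ δrules C →
           Pointwise (Reaches C) ts as → Reaches C (node f ts) a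
  ε-step : ∀ {t a a'} → Reaches C t a → (a , a') ∈ εrules C → Reaches C t a'

_∈L[_,_] : Term → BTA → Alphabet → Set
t ∈L[ C , A ] = GroundOver A t × ∃ λ a → a ∈ final C × Reaches C t a

-- EPRF-TRS: for every Σ ⊇ sign(R) and finite L ⊆ T_Σ one can effectively
-- construct a bta C over Σ with L(C) = R*_Σ(L).  "Effectively" is rendered
-- constructively as a (total, hence computable) function.

EPRF : TRS → Set
EPRF R = (A : Alphabet) → SignIn R A →
         (L : List Term) → LAll.All (GroundOver A) L →
         Σ BTA λ C → BTAOver A C × (∀ t → (t ∈L[ C , A ]) ⇔ (t ∈Desc[ R ] L))

-- The automaton given by the EPRF property only speaks about ground terms,
-- while p and q may contain variables.  The variables are therefore frozen:
-- every variable x is replaced by a constant  frozen x  whose name lies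
-- above all names of the alphabet A.  Rewriting is stable under
-- substitution, so p ⇒* q implies  freeze p ⇒* freeze q.  Conversely the
-- map  thaw , which turns the fresh constants back into variables, commutes
-- with rule instances (rules only use symbols of A) and hence maps a
-- rewrite sequence of the frozen terms back to one of p and q.

module Submission where

open import Defs
open import Relation.Nullary using (Dec; yes; no; ¬_)
import Relation.Nullary.Decidable as Dec
open import Relation.Nullary.Decidable using (_×-dec_; _⊎-dec_)
open import Relation.Binary.Definitions using (DecidableEquality)
open import Data.Nat using (ℕ; zero; suc; _+_; _∸_; _≤_; _<_; _⊔_; _≤?_; s≤s)
open import Data.Nat.Properties
  using (≤-totalOrder; ≤-refl; m≤m⊔n; m≤n⊔m; m+n∸m≡n; m≤m+n; ≤-trans; <⇒≱)
  renaming (_≟_ to _≟ℕ_)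
open import Data.Fin using (Fin; zero; suc) renaming (_≟_ to _≟F_)
open import Data.Product using (Σ; ∃; _×_; _,_; proj₁; proj₂)
open import Data.Product.Properties using (≡-dec)
open import Data.Sum using (_⊎_; inj₁; inj₂)
open import Data.Empty using (⊥-elim)
open import Data.List using (List; []; _∷_; _++_; map; upTo)
open import Data.List.Membership.Propositional using (_∈_; find; lose)
open import Data.List.Membership.Propositional.Properties using (∈-++⁺ˡ; ∈-++⁺ʳ; ∈-map⁺; ∈-upTo⁺)
open import Data.List.Relation.Unary.Any as LAny using (Any; here; there; any?)
open import Data.List.Relation.Unary.All as LAll using ()
open import Data.List.Extrema ≤-totalOrder using (max; xs≤max)
open import Data.Vec using (Vec; []; _∷_; lookup; _[_]≔_)
open import Data.Vec.Relation.Unary.All as VAll using ()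
open import Data.Vec.Relation.Unary.Any as VAny using ()
open import Data.Vec.Relation.Binary.Pointwise.Inductive using (Pointwise; []; _∷_)
open import Relation.Binary.Construct.Closure.ReflexiveTransitive using (Star; ε; _◅_; gmap; _◅◅_)
open import Relation.Binary.PropositionalEquality
open import Function.Bundles using (_⇔_; mk⇔; Equivalence)

mutual
  subst-comp : ∀ t σ θ → (t ⟨ σ ⟩) ⟨ θ ⟩ ≡ t ⟨ (λ x → σ x ⟨ θ ⟩) ⟩
  subst-comp (var x)     σ θ = refl
  subst-comp (node f ts) σ θ = cong (node f) (substVec-comp ts σ θ)

  substVec-comp : ∀ {n} (ts : Vec Term n) σ θ →
                  substVec (substVec ts σ) θ ≡ substVec ts (λ x → σ x ⟨ θ ⟩)
  substVec-comp []       σ θ = refl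
  substVec-comp (t ∷ ts) σ θ = cong₂ _∷_ (subst-comp t σ θ) (substVec-comp ts σ θ)

mutual
  subst-ext : ∀ t {σ σ′} → (∀ x → σ x ≡ σ′ x) → t ⟨ σ ⟩ ≡ t ⟨ σ′ ⟩
  subst-ext (var x)     eq = eq x
  subst-ext (node f ts) eq = cong (node f) (substVec-ext ts eq)

  substVec-ext : ∀ {n} (ts : Vec Term n) {σ σ′} → (∀ x → σ x ≡ σ′ x) →
                 substVec ts σ ≡ substVec ts σ′
  substVec-ext []       eq = refl
  substVec-ext (t ∷ ts) eq = cong₂ _∷_ (subst-ext t eq) (substVec-ext ts eq)

mutual
  subst-id : ∀ t → t ⟨ var ⟩ ≡ t
  subst-id (var x)     = refl
  subst-id (node f ts) = cong (node f) (substVec-id ts)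

  substVec-id : ∀ {n} (ts : Vec Term n) → substVec ts var ≡ ts
  substVec-id []       = refl
  substVec-id (t ∷ ts) = cong₂ _∷_ (subst-id t) (substVec-id ts)

lookup-subst : ∀ {n} (ts : Vec Term n) i σ → lookup (substVec ts σ) i ≡ lookup ts i ⟨ σ ⟩
lookup-subst (t ∷ ts) zero    σ = refl
lookup-subst (t ∷ ts) (suc i) σ = lookup-subst ts i σ

update-subst : ∀ {n} (ts : Vec Term n) i t′ σ →
               substVec (ts [ i ]≔ t′) σ ≡ substVec ts σ [ i ]≔ (t′ ⟨ σ ⟩)
update-subst (t ∷ ts) zero    t′ σ = refl
update-subst (t ∷ ts) (suc i) t′ σ = cong (_ ∷_) (update-subst ts i t′ σ)

⇒-subst : ∀ {R s t} θ → R ⊢ s ⇒ t → R ⊢ (s ⟨ θ ⟩) ⇒ (t ⟨ θ ⟩)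
⇒-subst {R} θ (root {l} {r} σ l→r) =
  subst₂ (R ⊢_⇒_) (sym (subst-comp l σ θ)) (sym (subst-comp r σ θ)) (root _ l→r)
⇒-subst {R} θ (inner {f} {ts} {t′} i step) =
  subst (λ us → R ⊢ node f (substVec ts θ) ⇒ node f us) (sym (update-subst ts i t′ θ))
    (inner i (subst (λ u → R ⊢ u ⇒ (t′ ⟨ θ ⟩)) (sym (lookup-subst ts i θ)) (⇒-subst θ step)))

⇒*-subst : ∀ {R s t} θ → R ⊢ s ⇒* t → R ⊢ (s ⟨ θ ⟩) ⇒* (t ⟨ θ ⟩)
⇒*-subst θ = gmap (_⟨ θ ⟩) (⇒-subst θ)

module _ {A A′ : Alphabet} (A⊆A′ : ∀ {f} → f ∈ A → f ∈ A′) where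
  mutual
    termOver-mono : ∀ {t} → TermOver A t → TermOver A′ t
    termOver-mono (var x)       = var x
    termOver-mono (node f∈A ts) = node (A⊆A′ f∈A) (termsOver-mono ts)

    termsOver-mono : ∀ {n} {ts : Vec Term n} →
                     VAll.All (TermOver A) ts → VAll.All (TermOver A′) ts
    termsOver-mono VAll.[]         = VAll.[]
    termsOver-mono (t VAll.∷ ts)   = termOver-mono t VAll.∷ termsOver-mono ts

  signIn-mono : ∀ {R} → SignIn R A → SignIn R A′
  signIn-mono = LAll.map (λ (l , r) → termOver-mono l , termOver-mono r)

freshName : Alphabet → ℕ
freshName A = suc (max 0 (map proj₁ A))

freshName-fresh : ∀ {A f} → f ∈ A → proj₁ f < freshName A
freshName-fresh {A} f∈A = s≤s (LAll.lookup (xs≤max 0 (map proj₁ A)) (∈-map⁺ proj₁ f∈A))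

mutual
  maxVar : Term → ℕ
  maxVar (var x)     = x
  maxVar (node f ts) = maxVars ts

  maxVars : ∀ {n} → Vec Term n → ℕ
  maxVars []       = 0
  maxVars (t ∷ ts) = maxVar t ⊔ maxVars ts

mutual
  occurs≤maxVar : ∀ {x t} → x occursIn t → x ≤ maxVar t
  occurs≤maxVar here       = ≤-refl
  occurs≤maxVar (there xs) = occurs≤maxVars xs

  occurs≤maxVars : ∀ {x n} {ts : Vec Term n} → VAny.Any (x occursIn_) ts → x ≤ maxVars ts
  occurs≤maxVars {ts = t ∷ ts} (VAny.here  x∈t)  = ≤-trans (occurs≤maxVar x∈t) (m≤m⊔n (maxVar t) (maxVars ts))
  occurs≤maxVars {ts = t ∷ ts} (VAny.there x∈ts) = ≤-trans (occurs≤maxVars x∈ts) (m≤n⊔m (maxVar t) (maxVars ts))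

module Freezing (N : ℕ) where

  frozenSym : ℕ → Sym
  frozenSym x = (N + x , 0)

  frozen : ℕ → Term
  frozen x = node (frozenSym x) []

  freeze : Term → Term
  freeze t = t ⟨ frozen ⟩

  mutual
    thaw : Term → Term
    thaw (var x) = var x
    thaw (node (k , zero) []) with N ≤? k
    ... | yes _ = var (k ∸ N)
    ... | no  _ = node (k , zero) []
    thaw (node (k , suc n) ts) = node (k , suc n) (thawVec ts)

    thawVec : ∀ {n} → Vec Term n → Vec Term n
    thawVec []       = []
    thawVec (t ∷ ts) = thaw t ∷ thawVec ts

  thaw-frozen : ∀ x → thaw (frozen x) ≡ var x
  thaw-frozen x with N ≤? N + x
  ... | yes _   = cong var (m+n∸m≡n N x)
  ... | no  N≰ = ⊥-elim (N≰ (m≤m+n N x))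

  lookup-thaw : ∀ {n} (ts : Vec Term n) i → lookup (thawVec ts) i ≡ thaw (lookup ts i)
  lookup-thaw (t ∷ ts) zero    = refl
  lookup-thaw (t ∷ ts) (suc i) = lookup-thaw ts i

  update-thaw : ∀ {n} (ts : Vec Term n) i t′ → thawVec (ts [ i ]≔ t′) ≡ thawVec ts [ i ]≔ thaw t′
  update-thaw (t ∷ ts) zero    t′ = refl
  update-thaw (t ∷ ts) (suc i) t′ = cong (_ ∷_) (update-thaw ts i t′)

  mutual
    freeze-ground : ∀ {A t} → TermOver A t → (∀ {x} → x occursIn t → frozenSym x ∈ A) →
                    GroundOver A (freeze t)
    freeze-ground (var x)       frozen∈A = node (frozen∈A here) VAll.[]
    freeze-ground (node f∈A ts) frozen∈A = node f∈A (freezeVec-ground ts (λ x∈ts → frozen∈A (there x∈ts)))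

    freezeVec-ground : ∀ {A n} {ts : Vec Term n} → VAll.All (TermOver A) ts →
                       (∀ {x} → VAny.Any (x occursIn_) ts → frozenSym x ∈ A) →
                       VAll.All (GroundOver A) (substVec ts frozen)
    freezeVec-ground VAll.[]         frozen∈A = VAll.[]
    freezeVec-ground (t VAll.∷ ts)   frozen∈A =
      freeze-ground t (λ x∈t → frozen∈A (VAny.here x∈t)) VAll.∷
      freezeVec-ground ts (λ x∈ts → frozen∈A (VAny.there x∈ts))

  module _ (A : Alphabet) (below : ∀ {f} → f ∈ A → proj₁ f < N) where
    mutual
      thaw-subst : ∀ {l} → TermOver A l → ∀ σ → thaw (l ⟨ σ ⟩) ≡ l ⟨ (λ x → thaw (σ x)) ⟩
      thaw-subst (var x) σ = refl
      thaw-subst (node {k , zero} {[]} f∈A VAll.[]) σ with N ≤? k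
      ... | yes N≤k = ⊥-elim (<⇒≱ (below f∈A) N≤k)
      ... | no  _   = refl
      thaw-subst (node {k , suc n} f∈A ts) σ = cong (node (k , suc n)) (thawVec-subst ts σ)

      thawVec-subst : ∀ {n} {ls : Vec Term n} → VAll.All (TermOver A) ls → ∀ σ →
                      thawVec (substVec ls σ) ≡ substVec ls (λ x → thaw (σ x))
      thawVec-subst VAll.[]         σ = refl
      thawVec-subst (l VAll.∷ ls)   σ = cong₂ _∷_ (thaw-subst l σ) (thawVec-subst ls σ)

    thaw-freeze : ∀ {t} → TermOver A t → thaw (freeze t) ≡ t
    thaw-freeze {t} t∈A = begin
      thaw (t ⟨ frozen ⟩)          ≡⟨ thaw-subst t∈A frozen ⟩
      t ⟨ (λ x → thaw (frozen x)) ⟩ ≡⟨ subst-ext t thaw-frozen ⟩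
      t ⟨ var ⟩                     ≡⟨ subst-id t ⟩
      t                             ∎
      where open ≡-Reasoning

    -- If the rules of R are over A, thawing maps rewrite steps to rewrite
    -- steps: a rule instance thaws to an instance of the same rule.
    module _ (R : TRS) (sig : SignIn R A) where
      ⇒-thaw : ∀ {s t} → R ⊢ s ⇒ t → R ⊢ thaw s ⇒ thaw t
      ⇒-thaw (root {l} {r} σ l→r) =
        subst₂ (R ⊢_⇒_) (sym (thaw-subst l∈A σ)) (sym (thaw-subst r∈A σ)) (root _ l→r)
        where
        l∈A : TermOver A l
        l∈A = proj₁ (LAll.lookup sig l→r)
        r∈A : TermOver A r
        r∈A = proj₂ (LAll.lookup sig l→r)
      ⇒-thaw (inner {k , zero} () step)
      ⇒-thaw (inner {k , suc n} {ts} {t′} i step) =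
        subst (λ us → R ⊢ node (k , suc n) (thawVec ts) ⇒ node (k , suc n) us) (sym (update-thaw ts i t′))
          (inner i (subst (λ u → R ⊢ u ⇒ thaw t′) (sym (lookup-thaw ts i)) (⇒-thaw step)))

      freeze-⇔ : ∀ {p q} → TermOver A p → TermOver A q →
                 (R ⊢ freeze p ⇒* freeze q) ⇔ (R ⊢ p ⇒* q)
      freeze-⇔ p∈A q∈A = mk⇔
        (λ steps → subst₂ (R ⊢_⇒*_) (thaw-freeze p∈A) (thaw-freeze q∈A) (gmap thaw ⇒-thaw steps))
        (⇒*-subst frozen)

module FiniteReachability {S : Set} (_≟_ : DecidableEquality S) where

  Edge : List (S × S) → S → S → Set
  Edge E a b = (a , b) ∈ E

  Reachable : List (S × S) → S → S → Set
  Reachable E = Star (Edge E)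

  weaken : ∀ {e E a b} → Reachable E a b → Reachable (e ∷ E) a b
  weaken = gmap (λ a → a) there

  -- A path using the new edge u → v passes through it, so it can be cut
  -- into a path to u and a path from v avoiding it.
  split : ∀ {u v E a b} → Reachable ((u , v) ∷ E) a b →
          Reachable E a b ⊎ (Reachable E a u × Reachable E v b)
  split ε = inj₁ ε
  split (here refl ◅ path) with split path
  ... | inj₁ v⇝b       = inj₂ (ε , v⇝b)
  ... | inj₂ (_ , v⇝b) = inj₂ (ε , v⇝b)
  split (there e ◅ path) with split path
  ... | inj₁ c⇝b         = inj₁ (e ◅ c⇝b)
  ... | inj₂ (c⇝u , v⇝b) = inj₂ (e ◅ c⇝u , v⇝b)

  reachable? : ∀ E a b → Dec (Reachable E a b)
  reachable? [] a b = Dec.map′ (λ { refl → ε }) (λ { ε → refl ; (() ◅ _) }) (a ≟ b)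
  reachable? ((u , v) ∷ E) a b =
    Dec.map′ (λ { (inj₁ a⇝b) → weaken a⇝b
                 ; (inj₂ (a⇝u , v⇝b)) → weaken a⇝u ◅◅ (here refl ◅ weaken v⇝b) })
             split
      (reachable? E a b ⊎-dec (reachable? E a u ×-dec reachable? E v b))

_≟Sym_ : DecidableEquality Sym
_≟Sym_ = ≡-dec _≟ℕ_ _≟ℕ_

-- Acceptance by a bottom-up tree automaton is decidable, by recursion on
-- the term: a run on  node f ts  is a δ-rule for f applied to runs on the
-- arguments, followed by a path of ε-rules.
module Acceptance (C : BTA) where
  open FiniteReachability {Fin (nStates C)} _≟F_

  State : Set
  State = Fin (nStates C)

  DeltaRule : Set
  DeltaRule = Σ Sym λ g → Vec State (rank g) × State

  ε-closure : ∀ {t a a′} → Reaches C t a → Reachable (εrules C) a a′ → Reaches C t a′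
  ε-closure run ε          = run
  ε-closure run (e ◅ path) = ε-closure (ε-step run e) path

  data Fires (f : Sym) (ts : Vec Term (rank f)) (a′ : State) : DeltaRule → Set where
    fires : ∀ {as a} → Pointwise (Reaches C) ts as → Reachable (εrules C) a a′ →
            Fires f ts a′ (f , as , a)

  fires⇔reaches : ∀ {f ts a′} → Any (Fires f ts a′) (δrules C) ⇔ Reaches C (node f ts) a′
  fires⇔reaches = mk⇔ run-of firing-of
    where
    run-of : ∀ {f ts a′} → Any (Fires f ts a′) (δrules C) → Reaches C (node f ts) a′
    run-of fired with find fired
    ... | _ , r∈C , fires args path = ε-closure (δ-step r∈C args) path

    firing-of : ∀ {f ts a′} → Reaches C (node f ts) a′ → Any (Fires f ts a′) (δrules C)
    firing-of (δ-step r∈C args) = lose r∈C (fires args ε)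
    firing-of (ε-step run e)    = LAny.map (λ { (fires args path) → fires args (path ◅◅ (e ◅ ε)) }) (firing-of run)

  var-unreachable : ∀ {x a} → ¬ Reaches C (var x) a
  var-unreachable (ε-step run _) = var-unreachable run

  mutual
    reaches? : ∀ t a → Dec (Reaches C t a)
    reaches? (var x)     a = no var-unreachable
    reaches? (node f ts) a = Dec.map fires⇔reaches (any? (fires? f ts a) (δrules C))

    fires? : ∀ f ts a′ (r : DeltaRule) → Dec (Fires f ts a′ r)
    fires? f ts a′ (g , as , a) with g ≟Sym f
    ... | no g≢f = no λ { (fires _ _) → g≢f refl }
    ... | yes refl = Dec.map′ (λ (args , path) → fires args path) (λ { (fires args path) → args , path })
                       (pointwise? ts as ×-dec reachable? (εrules C) a a′)

    pointwise? : ∀ {m} (ts : Vec Term m) (as : Vec State m) → Dec (Pointwise (Reaches C) ts as)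
    pointwise? []       []       = yes []
    pointwise? (t ∷ ts) (a ∷ as) = Dec.map′ (λ (run , runs) → run ∷ runs) (λ { (run ∷ runs) → run , runs })
                                     (reaches? t a ×-dec pointwise? ts as)

  accepts? : ∀ t → Dec (∃ λ a → a ∈ final C × Reaches C t a)
  accepts? t = Dec.map′ find (λ (a , a∈F , run) → lose a∈F run) (any? (reaches? t) (final C))

-- For ground p and q, build the automaton recognising the descendants of
-- p over A given by the EPRF property, and test whether it accepts q.
ground-reachability? : (A : Alphabet) (R : TRS) → SignIn R A → EPRF R →
                       ∀ {p q} → GroundOver A p → GroundOver A q → Dec (R ⊢ p ⇒* q)
ground-reachability? A R sig eprf {p} {q} p-ground q-ground
  with eprf A sig (p ∷ []) (p-ground LAll.∷ LAll.[])
... | C , _ , L[C]≡R*[p] = Dec.map′ descendant accepted (accepts? q)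
  where
  open Acceptance C using (accepts?)

  descendant : (∃ λ a → a ∈ final C × Reaches C q a) → R ⊢ p ⇒* q
  descendant run with Equivalence.to (L[C]≡R*[p] q) (q-ground , run)
  ... | _ , here refl , steps = steps

  accepted : R ⊢ p ⇒* q → ∃ λ a → a ∈ final C × Reaches C q a
  accepted steps = proj₂ (Equivalence.from (L[C]≡R*[p] q) (p , here refl , steps))

-- Over the
-- alphabet A′, which adds the frozen constants of all variables up to the
-- largest one of p and q, the frozen terms are ground, so the ground case
-- decides  freeze p ⇒* freeze q , which is equivalent to  p ⇒* q .
mainTheorem2 : (A : Alphabet) (R : TRS) → SignIn R A → EPRF R →
    (p q : Term) → TermOver A p → TermOver A q →
    Dec (R ⊢ p ⇒* q)
mainTheorem2 A R sig eprf p q p∈A q∈A =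
  Dec.map (freeze-⇔ A (freshName-fresh {A}) R sig p∈A q∈A)
    (ground-reachability? A′ R (signIn-mono A⊆A′ {R} sig) eprf
      (freeze-ground (termOver-mono A⊆A′ p∈A) (λ x∈p → frozen∈A′ (≤-trans (occurs≤maxVar x∈p) p≤bound)))
      (freeze-ground (termOver-mono A⊆A′ q∈A) (λ x∈q → frozen∈A′ (≤-trans (occurs≤maxVar x∈q) q≤bound))))
  where
  open Freezing (freshName A)

  bound : ℕ
  bound = maxVar p ⊔ maxVar q

  p≤bound : maxVar p ≤ bound
  p≤bound = m≤m⊔n (maxVar p) (maxVar q)

  q≤bound : maxVar q ≤ bound
  q≤bound = m≤n⊔m (maxVar p) (maxVar q)

  A′ : Alphabet
  A′ = A ++ map frozenSym (upTo (suc bound))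

  A⊆A′ : ∀ {f} → f ∈ A → f ∈ A′
  A⊆A′ = ∈-++⁺ˡ

  frozen∈A′ : ∀ {x} → x ≤ bound → frozenSym x ∈ A′
  frozen∈A′ x≤bound = ∈-++⁺ʳ A (∈-map⁺ frozenSym (∈-upTo⁺ (s≤s x≤bound)))
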